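{- Let $k,a,b$ be positive real numbers. For any integer $n\ge0$, $\sum_{i=0}^n\binom ni k^i S_{k,i}^{(a,b)}=S_{k,2n}^{(a,b)}.$
   Context: The $k$-FL sequence is $S_{k,0}^{(a,b)}=2b$, $S_{k,1}^{(a,b)}=bk+a$, $S_{k,n}^{(a,b)}=kS_{k,n-1}^{(a,b)}+S_{k,n-2}^{(a,b)}$ for $n\ge2$. -}

module Defs where

open import Level using (Level)
open import Data.Nat using (ℕ; zero; suc)
open import Algebra.Bundles using (CommutativeRing)

module _ {c ℓ : Level} (R : CommutativeRing c ℓ) where
  open CommutativeRing R hiding (zero)

  kFL : (k a b : Carrier) → ℕ → Carrier
  kFL k a b zero = b + b
  kFL k a b (suc zero) = b * k + a
  kFL k a b (suc (suc n)) = k * kFL k a b (suc n) + kFL k a b n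

  sumTo : (ℕ → Carrier) → ℕ → Carrier
  sumTo f zero = f zero
  sumTo f (suc n) = sumTo f n + f (suc n)

module Submission where

-- For a scalar k and a sequence f in a commutative ring, write
--   T f n = Σ_{i ≤ n} C(n,i) k^i f(i)
-- for the k-weighted binomial transform of f.  Pascal's rule
-- C(n+1,i+1) = C(n,i) + C(n,i+1) gives the one-step relation
--   T f (n+1) = T f n + k · T (f ∘ suc) n.
-- If f obeys the k-Fibonacci recurrence f(j+2) = k f(j+1) + f(j), then so
-- does its shift f ∘ suc, and induction on n (for all such f at once) gives
--   T f (n+1) = f(2n) + k f(2n+1) = f(2n+2),
-- i.e. T f n = f(2n).  The k-FL sequence satisfies the recurrence by
-- definition, whatever its initial values 2b and bk + a, which yields the
-- theorem.

open import Defs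
open import Level using (Level)
open import Data.Nat using (ℕ; _*_)
open import Data.Nat.Combinatorics using (_C_)
open import Algebra.Bundles using (CommutativeRing; Semiring)
open import Algebra.Definitions.RawSemiring using (_×_; _^_)

open import Function using (_∘_)
open import Data.Nat.Properties using (n<1+n; *-suc)
open import Data.Nat.Combinatorics using (k>n⇒nCk≡0; nCk+nC[k+1]≡[n+1]C[k+1])
open import Relation.Binary.PropositionalEquality as ≡ using (_≡_)
import Algebra.Properties.Semiring.Mult as SemiringMult
import Algebra.Properties.CommutativeSemigroup as CommutativeSemigroupProperties
import Relation.Binary.Reasoning.Setoid as SetoidReasoning

module BinomialTransform {c ℓ : Level} (R : CommutativeRing c ℓ) where
  open CommutativeRing R renaming (_*_ to _·_)
  open SemiringMult semiring using (×-homo-+; ×-homo-0; ×-congˡ; ×-congʳ; ×-comm-*)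
  open CommutativeSemigroupProperties +-commutativeSemigroup using (interchange)
  open SetoidReasoning setoid

  infixr 8 _↑_
  _↑_ : Carrier → ℕ → Carrier
  _↑_ = _^_ (Semiring.rawSemiring semiring)

  infixr 8 _⊗_
  _⊗_ : ℕ → Carrier → Carrier
  _⊗_ = _×_ (Semiring.rawSemiring semiring)

  Σ : (ℕ → Carrier) → ℕ → Carrier
  Σ = sumTo R

  Σ-cong : ∀ {f g} → (∀ i → f i ≈ g i) → ∀ n → Σ f n ≈ Σ g n
  Σ-cong f≈g ℕ.zero    = f≈g 0
  Σ-cong f≈g (ℕ.suc n) = +-cong (Σ-cong f≈g n) (f≈g (ℕ.suc n))

  Σ-+ : ∀ f g n → Σ (λ i → f i + g i) n ≈ Σ f n + Σ g n
  Σ-+ f g ℕ.zero    = refl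
  Σ-+ f g (ℕ.suc n) = trans (+-congʳ (Σ-+ f g n)) (interchange _ _ _ _)

  Σ-· : ∀ x f n → Σ (λ i → x · f i) n ≈ x · Σ f n
  Σ-· x f ℕ.zero    = refl
  Σ-· x f (ℕ.suc n) = trans (+-congʳ (Σ-· x f n)) (sym (distribˡ x _ _))

  Σ-peel : ∀ f n → Σ f (ℕ.suc n) ≈ f 0 + Σ (f ∘ ℕ.suc) n
  Σ-peel f ℕ.zero    = refl
  Σ-peel f (ℕ.suc n) = trans (+-congʳ (Σ-peel f n)) (+-assoc _ _ _)

  Σ-drop-last : ∀ f n → f (ℕ.suc n) ≈ 0# → Σ f (ℕ.suc n) ≈ Σ f n
  Σ-drop-last f n fₙ₊₁≈0 = trans (+-congˡ fₙ₊₁≈0) (+-identityʳ _)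

  transform : Carrier → (ℕ → Carrier) → ℕ → Carrier
  transform k f n = Σ (λ i → (n C i) ⊗ (k ↑ i · f i)) n

  -- Pascal's rule lifted to the transform:
  -- T f (n+1) = T f n + k · T (f ∘ suc) n.
  transform-suc : ∀ k f n →
    transform k f (ℕ.suc n) ≈ transform k f n + k · transform k (f ∘ ℕ.suc) n
  transform-suc k f n = begin
    transform k f (ℕ.suc n)
      ≈⟨ Σ-peel _ n ⟩
    (n C 0) ⊗ g 0 + Σ (λ i → (ℕ.suc n C ℕ.suc i) ⊗ g (ℕ.suc i)) n
      ≈⟨ +-congˡ (Σ-cong pascal n) ⟩
    (n C 0) ⊗ g 0 + Σ (λ i → (n C ℕ.suc i) ⊗ g (ℕ.suc i) + (n C i) ⊗ g (ℕ.suc i)) n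
      ≈⟨ +-congˡ (Σ-+ _ _ n) ⟩
    (n C 0) ⊗ g 0 + (Σ (λ i → (n C ℕ.suc i) ⊗ g (ℕ.suc i)) n + Σ (λ i → (n C i) ⊗ g (ℕ.suc i)) n)
      ≈⟨ sym (+-assoc _ _ _) ⟩
    ((n C 0) ⊗ g 0 + Σ (λ i → (n C ℕ.suc i) ⊗ g (ℕ.suc i)) n) + Σ (λ i → (n C i) ⊗ g (ℕ.suc i)) n
      ≈⟨ +-congʳ (Σ-peel _ n) ⟨
    Σ (λ i → (n C i) ⊗ g i) (ℕ.suc n) + Σ (λ i → (n C i) ⊗ g (ℕ.suc i)) n
      ≈⟨ +-cong lower-terms shifted-terms ⟩
    transform k f n + k · transform k (f ∘ ℕ.suc) n ∎
    where
    g : ℕ → Carrier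
    g i = k ↑ i · f i

    pascal : ∀ i → (ℕ.suc n C ℕ.suc i) ⊗ g (ℕ.suc i)
                   ≈ (n C ℕ.suc i) ⊗ g (ℕ.suc i) + (n C i) ⊗ g (ℕ.suc i)
    pascal i = trans (×-congˡ (≡.sym (nCk+nC[k+1]≡[n+1]C[k+1] n i)))
                     (trans (×-homo-+ _ (n C i) (n C ℕ.suc i)) (+-comm _ _))

    lower-terms : Σ (λ i → (n C i) ⊗ g i) (ℕ.suc n) ≈ transform k f n
    lower-terms = Σ-drop-last _ n
      (trans (×-congˡ (k>n⇒nCk≡0 (n<1+n n))) (×-homo-0 (g (ℕ.suc n))))

    -- k^(i+1) = k · k^i, so a factor k comes out of every shifted term.
    shifted-terms : Σ (λ i → (n C i) ⊗ g (ℕ.suc i)) n ≈ k · transform k (f ∘ ℕ.suc) n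
    shifted-terms = trans
      (Σ-cong (λ i → trans (×-congʳ (n C i) (*-assoc k (k ↑ i) (f (ℕ.suc i))))
                           (sym (×-comm-* (n C i) k _))) n)
      (Σ-· k _ n)

  KFibonacci : Carrier → (ℕ → Carrier) → Set ℓ
  KFibonacci k f = ∀ j → f (ℕ.suc (ℕ.suc j)) ≈ k · f (ℕ.suc j) + f j

  transform-KFibonacci : ∀ k f → KFibonacci k f → ∀ n → transform k f n ≈ f (2 * n)
  transform-KFibonacci k f rec ℕ.zero    = trans (+-identityʳ _) (*-identityˡ _)
  transform-KFibonacci k f rec (ℕ.suc n) = begin
    transform k f (ℕ.suc n)
      ≈⟨ transform-suc k f n ⟩
    transform k f n + k · transform k (f ∘ ℕ.suc) n
      ≈⟨ +-cong (transform-KFibonacci k f rec n)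
                (*-congˡ (transform-KFibonacci k (f ∘ ℕ.suc) (rec ∘ ℕ.suc) n)) ⟩
    f (2 * n) + k · f (ℕ.suc (2 * n))
      ≈⟨ +-comm _ _ ⟩
    k · f (ℕ.suc (2 * n)) + f (2 * n)
      ≈⟨ rec (2 * n) ⟨
    f (ℕ.suc (ℕ.suc (2 * n)))
      ≡⟨ ≡.cong f (*-suc 2 n) ⟨
    f (2 * ℕ.suc n) ∎

  kFL-KFibonacci : ∀ k a b → KFibonacci k (kFL R k a b)
  kFL-KFibonacci k a b j = refl

mainTheorem12 : {c ℓ : Level} (R : CommutativeRing c ℓ) →
    let open CommutativeRing R renaming (_*_ to _·_) in
    (k a b : Carrier) (n : ℕ) →
    sumTo R (λ i → _×_ (Semiring.rawSemiring semiring) (n C i) ((_^_ (Semiring.rawSemiring semiring) k i) · kFL R k a b i)) n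
      ≈ kFL R k a b (2 * n)
mainTheorem12 R k a b =
  transform-KFibonacci k (kFL R k a b) (kFL-KFibonacci k a b)
  where open BinomialTransform R
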